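{- There is an absolute constant $c$ such that the following holds. Let $G$ be a graph, let $A$ and $B$ be branches of $G$ (possibly $A=B$), and let $s$ be a vertex of $G$. Then the indistinct set for $s$, $A$, $B$, namely the set of pairs $(a,b)$ of vertices with $a\in A$, $b\in B$ and $d(s,a)=d(s,b)$, has at most $c\cdot\min(|A|,|B|)$ elements.
   Context: $d(u,v)$ denotes shortest-path distance in $G$. A branch of $G$ is a maximal path or cycle in $G$ in which every internal vertex of the path has degree two in $G$; $|A|$ denotes the number of vertices of branch $A$. (In the paper $s$ is taken to be a vertex of a locating set, but the statement concerns an arbitrary vertex $s$.) -}

module Defs where

open import Data.Nat using (ℕ; zero; suc; _<_; _≤_; _*_; _⊓_)
open import Data.Bool using (Bool; true; false; T)
open import Data.Fin using (Fin; toℕ)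
open import Data.List using (List; []; _∷_; length; lookup; filter; allFin)
open import Data.List.Relation.Unary.Unique.Propositional using (Unique)
open import Data.List.Relation.Unary.Linked using (Linked)
open import Data.List.Relation.Binary.Subset.Propositional using (_⊆_)
open import Data.Product using (Σ; _×_; _,_; ∃; ∃-syntax)
open import Data.List.Membership.Propositional using (_∈_)
open import Data.Sum using (_⊎_)
open import Relation.Binary.PropositionalEquality using (_≡_)
open import Relation.Nullary using (¬_)
open import Relation.Nullary.Decidable using (T?)

record Graph : Set where
  field
    n      : ℕ
    adj    : Fin n → Fin n → Bool
    sym    : ∀ u v → adj u v ≡ adj v u
    irrefl : ∀ u → adj u u ≡ false

open Graph public

Vertex : Graph → Set
Vertex G = Fin (n G)

Adj : (G : Graph) → Vertex G → Vertex G → Set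
Adj G u v = T (adj G u v)

degree : (G : Graph) → Vertex G → ℕ
degree G v = length (filter (λ u → T? (adj G v u)) (allFin (n G)))

data Walk (G : Graph) : Vertex G → Vertex G → ℕ → Set where
  here : ∀ {u} → Walk G u u 0
  step : ∀ {u v w k} → Adj G u v → Walk G v w k → Walk G u w (suc k)

Connected : Graph → Set
Connected G = ∀ u v → ∃[ k ] Walk G u v k

Dist : (G : Graph) → Vertex G → Vertex G → ℕ → Set
Dist G u v k = Walk G u v k × (∀ m → m < k → ¬ Walk G u v m)

SameDist : (G : Graph) → Vertex G → Vertex G → Vertex G → Set
SameDist G s a b = ∃[ k ] (Dist G s a k × Dist G s b k)

PathShape : (G : Graph) → List (Vertex G) → Set
PathShape G vs =
  (∀ (i : Fin (length vs)) → 0 < toℕ i → suc (toℕ i) < length vs →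
     degree G (lookup vs i) ≡ 2)

-- A cycle v0 v1 … vk v0 (k ≥ 2) whose internal vertices v1 … vk have degree 2 in G.
CycleShape : (G : Graph) → List (Vertex G) → Set
CycleShape G vs =
  (3 ≤ length vs) ×
  (∀ (i j : Fin (length vs)) → toℕ i ≡ 0 → suc (toℕ j) ≡ length vs →
     Adj G (lookup vs j) (lookup vs i)) ×
  (∀ (i : Fin (length vs)) → 0 < toℕ i → degree G (lookup vs i) ≡ 2)

BranchShape : (G : Graph) → List (Vertex G) → Set
BranchShape G vs =
  (1 ≤ length vs) × Unique vs × Linked (Adj G) vs × (PathShape G vs ⊎ CycleShape G vs)

IsBranch : (G : Graph) → List (Vertex G) → Set
IsBranch G vs =
  BranchShape G vs × (∀ ws → BranchShape G ws → vs ⊆ ws → ws ⊆ vs)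

∣_∣ᵥ : {A : Set} → List A → ℕ
∣ vs ∣ᵥ = length vs

Indistinct : (G : Graph) → Vertex G → List (Vertex G) → List (Vertex G) →
             Vertex G × Vertex G → Set
Indistinct G s A B (a , b) = (a ∈ A) × (b ∈ B) × SameDist G s a b

module Submission where

-- Walk along a branch A and record d(s, ·) at each position.  At a position strictly inside the
-- branch that is not s itself, the vertex has degree two, so a shortest walk from s reaches it
-- through one of its two branch neighbours: the profile drops by one towards one side.  Once the
-- profile drops in some direction it keeps dropping in that direction while it stays inside
-- (a step back would contradict the distance just computed).  Consequently, on a stretch of the
-- branch whose inner positions avoid s, no distance value occurs at three positions; since s
-- splits the branch into two such stretches, every distance level meets A in at most 4 vertices.

open import Defs hiding (sym)
open import Data.Nat using (ℕ; zero; suc; pred; _+_; _*_; _⊓_; _≤_; _<_; z≤n; s≤s; _∸_; _≤?_)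
open import Data.Nat.Properties
open import Data.Bool using (T)
open import Data.Fin using (Fin; toℕ; fromℕ<) renaming (zero to fzero; suc to fsuc)
open import Data.Fin.Properties using (toℕ-fromℕ<) renaming (_≟_ to _≟ᶠ_)
open import Data.Product using (_×_; _,_; proj₁; proj₂; ∃; ∃-syntax; swap)
open import Data.Product.Properties using (×-≡,≡→≡)
open import Data.Sum using (_⊎_; inj₁; inj₂)
open import Data.Empty using (⊥; ⊥-elim)
open import Function using (_∘_)
open import Data.List using (List; []; _∷_; length; lookup; filter; map; allFin)
open import Data.List.Properties using (length-map)
open import Data.List.Relation.Unary.All using (All; []; _∷_)
import Data.List.Relation.Unary.All as All
import Data.List.Relation.Unary.All.Properties as Allₚ
open import Data.List.Relation.Unary.Any using (here; there)
open import Data.List.Relation.Unary.AllPairs using ([]; _∷_)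
open import Data.List.Relation.Unary.Unique.Propositional using (Unique)
import Data.List.Relation.Unary.Unique.Propositional.Properties as Uniqueₚ
open import Data.List.Relation.Unary.Linked using (Linked; [-]; _∷_)
open import Data.List.Membership.Propositional using (_∈_)
open import Data.List.Membership.Propositional.Properties using (∈-filter⁺; ∈-allFin)
open import Relation.Binary.PropositionalEquality using (_≡_; _≢_; refl; sym; trans; cong; subst)
open import Relation.Binary.Definitions using (DecidableEquality; tri<; tri≈; tri>)
open import Relation.Nullary using (yes; no; ¬?)
open import Relation.Nullary.Decidable using (T?)
open import Relation.Unary using (Decidable)

module _ {X : Set} where

  length-split : {P : X → Set} (P? : Decidable P) (xs : List X) →
                 length xs ≡ length (filter P? xs) + length (filter (¬? ∘ P?) xs)
  length-split P? [] = refl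
  length-split P? (x ∷ xs) with P? x
  ... | yes _ = cong suc (length-split P? xs)
  ... | no  _ = trans (cong suc (length-split P? xs)) (sym (+-suc _ _))

  atMostTwo : {P : X → Set} {xs : List X} → Unique xs → All P xs →
              (∀ {x y z} → P x → P y → P z → x ≢ y → x ≢ z → y ≢ z → ⊥) → length xs ≤ 2
  atMostTwo {xs = []}          _ _ _ = z≤n
  atMostTwo {xs = _ ∷ []}      _ _ _ = s≤s z≤n
  atMostTwo {xs = _ ∷ _ ∷ []}  _ _ _ = s≤s (s≤s z≤n)
  atMostTwo ((x≢y ∷ x≢z ∷ _) ∷ (y≢z ∷ _) ∷ _) (px ∷ py ∷ pz ∷ _) noThree =
    ⊥-elim (noThree px py pz x≢y x≢z y≢z)

  one≤length : ∀ {x : X} {xs} → x ∈ xs → 1 ≤ length xs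
  one≤length (here _)  = s≤s z≤n
  one≤length (there _) = s≤s z≤n

  two≤length : ∀ {x y : X} {xs} → x ∈ xs → y ∈ xs → x ≢ y → 2 ≤ length xs
  two≤length (here refl) (here refl) x≢y = ⊥-elim (x≢y refl)
  two≤length (here refl) (there y∈) _    = s≤s (one≤length y∈)
  two≤length (there x∈)  (here refl) _   = s≤s (one≤length x∈)
  two≤length (there x∈)  (there y∈) x≢y  = m≤n⇒m≤1+n (two≤length x∈ y∈ x≢y)

  three≤length : ∀ {x y z : X} {xs} → x ∈ xs → y ∈ xs → z ∈ xs →
                 x ≢ y → x ≢ z → y ≢ z → 3 ≤ length xs
  three≤length (here refl) (here refl) _           x≢y _   _   = ⊥-elim (x≢y refl)
  three≤length (here refl) (there _)   (here refl) _   x≢z _   = ⊥-elim (x≢z refl)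
  three≤length (there _)   (here refl) (here refl) _   _   y≢z = ⊥-elim (y≢z refl)
  three≤length (here refl) (there y∈)  (there z∈)  _   _   y≢z = s≤s (two≤length y∈ z∈ y≢z)
  three≤length (there x∈)  (here refl) (there z∈)  _   x≢z _   = s≤s (two≤length x∈ z∈ x≢z)
  three≤length (there x∈)  (there y∈)  (here refl) x≢y _   _   = s≤s (two≤length x∈ y∈ x≢y)
  three≤length (there x∈)  (there y∈)  (there z∈)  x≢y x≢z y≢z =
    m≤n⇒m≤1+n (three≤length x∈ y∈ z∈ x≢y x≢z y≢z)

  at : List X → X → ℕ → X
  at []       d _       = d
  at (x ∷ _)  _ zero    = x
  at (_ ∷ xs) d (suc p) = at xs d p

  at-∈ : ∀ xs {d p} → p < length xs → at xs d p ∈ xs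
  at-∈ (_ ∷ _)  {p = zero}  _          = here refl
  at-∈ (_ ∷ xs) {p = suc p} (s≤s p<)   = there (at-∈ xs p<)

  at-injective : ∀ {xs d p q} → Unique xs → p < length xs → q < length xs →
                 at xs d p ≡ at xs d q → p ≡ q
  at-injective {_ ∷ _}  {p = zero}  {zero}  _ _ _ _ = refl
  at-injective {_ ∷ xs} {p = zero}  {suc q} (x∉ ∷ _) _ (s≤s q<) e =
    ⊥-elim (All.lookup x∉ (at-∈ xs q<) e)
  at-injective {_ ∷ xs} {p = suc p} {zero}  (x∉ ∷ _) (s≤s p<) _ e =
    ⊥-elim (All.lookup x∉ (at-∈ xs p<) (sym e))
  at-injective {_ ∷ _}  {p = suc p} {suc q} (_ ∷ u) (s≤s p<) (s≤s q<) e =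
    cong suc (at-injective u p< q< e)

  at-length : ∀ xs {d} → at xs d (length xs) ≡ d
  at-length []       = refl
  at-length (_ ∷ xs) = at-length xs

  lookup≡at : ∀ xs {d} (i : Fin (length xs)) → lookup xs i ≡ at xs d (toℕ i)
  lookup≡at (_ ∷ _)  fzero    = refl
  lookup≡at (_ ∷ xs) (fsuc i) = lookup≡at xs i

  at-fromℕ< : ∀ {xs d p} (p< : p < length xs) → lookup xs (fromℕ< p<) ≡ at xs d p
  at-fromℕ< {xs} p< = trans (lookup≡at xs (fromℕ< p<)) (cong (at xs _) (toℕ-fromℕ< p<))

  at-linked : ∀ {R : X → X → Set} {xs d p} → Linked R xs → suc p < length xs →
              R (at xs d p) (at xs d (suc p))
  at-linked              [-]     (s≤s ())
  at-linked {p = zero}  (r ∷ _) _          = r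
  at-linked {p = suc p} (_ ∷ l) (s≤s sp<)  = at-linked l sp<

  pred≢suc-at : ∀ {xs d p} → Unique xs → suc p < length xs → at xs d (pred p) ≢ at xs d (suc p)
  pred≢suc-at {p = p} u sp< e =
    <⇒≢ pred<suc (at-injective u (<-trans pred<suc sp<) sp< e)
    where
    pred<suc : pred p < suc p
    pred<suc = s≤s pred[n]≤n

  module Positions (_≟_ : DecidableEquality X) where

    position : List X → X → ℕ
    position []       _ = 0
    position (x ∷ xs) a with a ≟ x
    ... | yes _ = 0
    ... | no  _ = suc (position xs a)

    at-position : ∀ {xs d a} → a ∈ xs → at xs d (position xs a) ≡ a
    at-position {x ∷ _} {a = a} a∈ with a ≟ x
    ... | yes a≡x = sym a≡x
    at-position (here a≡x) | no a≢x = ⊥-elim (a≢x a≡x)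
    at-position (there a∈) | no _   = at-position a∈

    position<length : ∀ {xs a} → a ∈ xs → position xs a < length xs
    position<length {x ∷ _} {a} a∈ with a ≟ x
    ... | yes _ = s≤s z≤n
    position<length (here a≡x) | no a≢x = ⊥-elim (a≢x a≡x)
    position<length (there a∈) | no _   = s≤s (position<length a∈)

    position-at : ∀ {xs d p} → Unique xs → p < length xs → position xs (at xs d p) ≡ p
    position-at {xs} u p< =
      at-injective u (position<length (at-∈ xs p<)) p< (at-position (at-∈ xs p<))

distinct-triple : {P : ℕ → Set} → (∀ {i j l} → i < j → j < l → P i → P j → P l → ⊥) →
                  ∀ {i j l} → P i → P j → P l → i ≢ j → i ≢ l → j ≢ l → ⊥
distinct-triple inc {i} {j} {l} pi pj pl i≢j i≢l j≢l with <-cmp i j | <-cmp j l | <-cmp i l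
... | tri≈ _ i≡j _ | _            | _            = i≢j i≡j
... | _            | tri≈ _ j≡l _ | _            = j≢l j≡l
... | _            | _            | tri≈ _ i≡l _ = i≢l i≡l
... | tri< i<j _ _ | tri< j<l _ _ | _            = inc i<j j<l pi pj pl
... | tri< _ _ _   | tri> _ _ l<j | tri< i<l _ _ = inc i<l l<j pi pl pj
... | tri< i<j _ _ | tri> _ _ _   | tri> _ _ l<i = inc l<i i<j pl pi pj
... | tri> _ _ j<i | tri< _ _ _   | tri< i<l _ _ = inc j<i i<l pj pi pl
... | tri> _ _ _   | tri< j<l _ _ | tri> _ _ l<i = inc j<l l<i pj pl pi
... | tri> _ _ j<i | tri> _ _ l<j | _            = inc l<j j<i pl pj pi

gap : ∀ {m n} → m < n → ∃[ o ] n ≡ suc (o + m)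
gap {m} {n} m<n = n ∸ suc m , sym (trans (sym (+-suc (n ∸ suc m) m)) (m∸n+n≡m m<n))

module _ (G : Graph) where

  adj-sym : ∀ {u v} → Adj G u v → Adj G v u
  adj-sym {u} {v} = subst T (Graph.sym G u v)

  degree-two : ∀ {v a b u} → degree G v ≡ 2 → Adj G v a → Adj G v b → a ≢ b → Adj G v u →
               u ≡ a ⊎ u ≡ b
  degree-two {v} {a} {b} {u} deg va vb a≢b vu with u ≟ᶠ a | u ≟ᶠ b
  ... | yes u≡a | _       = inj₁ u≡a
  ... | no _    | yes u≡b = inj₂ u≡b
  ... | no u≢a  | no u≢b  = ⊥-elim (1+n≰n (subst (3 ≤_) deg
          (three≤length (neighbour va) (neighbour vb) (neighbour vu) a≢b (u≢a ∘ sym) (u≢b ∘ sym))))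
    where
    neighbour : ∀ {x} → Adj G v x → x ∈ filter (λ y → T? (adj G v y)) (allFin (n G))
    neighbour {x} = ∈-filter⁺ (λ y → T? (adj G v y)) (∈-allFin x)

  snoc : ∀ {u v w k} → Walk G u v k → Adj G v w → Walk G u w (suc k)
  snoc here         vw = step vw here
  snoc (step uv wk) vw = step uv (snoc wk vw)

  unsnoc : ∀ {u w k} → Walk G u w (suc k) → ∃[ v ] Walk G u v k × Adj G v w
  unsnoc (step uw here) = _ , here , uw
  unsnoc (step uv wk@(step _ _)) with unsnoc wk
  ... | v , wk' , vw = v , step uv wk' , vw

  dist-unique : ∀ {u v k k'} → Dist G u v k → Dist G u v k' → k ≡ k'
  dist-unique {k = k} {k'} (wk , shortest) (wk' , shortest') with <-cmp k k'
  ... | tri< k<k' _ _ = ⊥-elim (shortest' k k<k' wk)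
  ... | tri≈ _ k≡k' _ = k≡k'
  ... | tri> _ _ k'<k = ⊥-elim (shortest k' k'<k wk')

  dist-step : ∀ {s v x} → Dist G s v x → v ≢ s → ∃[ x' ] x ≡ suc x' × ∃[ u ] Adj G u v × Dist G s u x'
  dist-step {x = zero}  (here , _) v≢s = ⊥-elim (v≢s refl)
  dist-step {x = suc x} (wk , shortest) _ with unsnoc wk
  ... | u , wk' , uv = x , refl , u , uv , wk' ,
                       λ m m<x short → shortest (suc m) (s≤s m<x) (snoc short uv)

-- The profile argument.  D p x reads "the distance at position p is x"; D is functional, and at
-- an interior position the distance is one more than at one of the two adjacent positions.
module Profile (D : ℕ → ℕ → Set) (Interior : ℕ → Set)
  (functional : ∀ {p x y} → D p x → D p y → x ≡ y)
  (descent : ∀ {p x} → Interior p → D p x → ∃[ x' ] x ≡ suc x' × (D (pred p) x' ⊎ D (suc p) x'))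
  where

  -- A drop from q to q + 1 continues to q + 2 when q + 1 is interior: going back up is impossible.
  keepsDroppingʳ : ∀ {q y} → D q (suc y) → D (suc q) y → Interior (suc q) →
                   ∃[ y' ] y ≡ suc y' × D (suc (suc q)) y'
  keepsDroppingʳ dq dq₁ int with descent int dq₁
  ... | y' , refl , inj₁ dq' = ⊥-elim (m≢1+n+m y' (sym (functional dq dq')))
  ... | y' , refl , inj₂ dq₂ = y' , refl , dq₂

  keepsDroppingˡ : ∀ {q y} → D (suc q) (suc y) → D q y → Interior q →
                   ∃[ y' ] y ≡ suc y' × D (pred q) y'
  keepsDroppingˡ dq₁ dq int with descent int dq
  ... | y' , refl , inj₁ dq' = y' , refl , dq'
  ... | y' , refl , inj₂ dq₁' = ⊥-elim (m≢1+n+m y' (sym (functional dq₁ dq₁')))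

  droppingʳ : ∀ n {q y z} → D q (suc y) → D (suc q) y → (∀ t → q < t → t ≤ n + q → Interior t) →
              D (suc (n + q)) z → z ≤ y
  droppingʳ zero    dq dq₁ _ dz = ≤-reflexive (functional dz dq₁)
  droppingʳ (suc n) {q} {z = z} dq dq₁ inner dz
    with keepsDroppingʳ dq dq₁ (inner (suc q) (n<1+n q) (s≤s (m≤n+m q n)))
  ... | _ , refl , dq₂ = m≤n⇒m≤1+n (droppingʳ n dq₁ dq₂ inner' dz')
    where
    inner' : ∀ t → suc q < t → t ≤ n + suc q → Interior t
    inner' t sq<t t≤ = inner t (<-trans (n<1+n q) sq<t) (subst (t ≤_) (+-suc n q) t≤)
    dz' : D (suc (n + suc q)) z
    dz' = subst (λ p → D p z) (cong suc (sym (+-suc n q))) dz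

  droppingˡ : ∀ n {q y z} → D (suc (n + q)) (suc y) → D (n + q) y →
              (∀ t → q < t → t ≤ n + q → Interior t) → D q z → z ≤ y
  droppingˡ zero    _ dq _ dz = ≤-reflexive (functional dz dq)
  droppingˡ (suc n) {q} dtop dnext inner dz
    with keepsDroppingˡ dtop dnext (inner (suc (n + q)) (s≤s (m≤n+m q n)) ≤-refl)
  ... | _ , refl , dnext' =
    m≤n⇒m≤1+n (droppingˡ n dnext dnext' (λ t q<t t≤ → inner t q<t (m≤n⇒m≤1+n t≤)) dz)

  -- No value is taken at three positions i < j < l when everything strictly between i and l is
  -- interior: at j the profile drops to one side and never comes back up on that side.
  noThreeIncreasing : ∀ {i j l k} → i < j → j < l → D i k → D j k → D l k →
                      (∀ q → i < q → q < l → Interior q) → ⊥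
  noThreeIncreasing {i} {j} i<j j<l di dj dl inner with descent (inner j i<j j<l) dj
  ... | k' , refl , inj₂ dj₁ with gap j<l
  ...   | o , refl = 1+n≰n (droppingʳ o dj dj₁ (λ t j<t t≤ → inner t (<-trans i<j j<t) (s≤s t≤)) dl)
  noThreeIncreasing {i} {j} i<j j<l di dj dl inner | k' , refl , inj₁ dj₀ with gap i<j
  ...   | o , refl = 1+n≰n (droppingˡ o dj dj₀ (λ t i<t t≤ → inner t i<t (<-trans (s≤s t≤) j<l)) di)

  InSegment : ℕ → ℕ → ℕ → ℕ → Set
  InSegment lo hi k p = lo ≤ p × p ≤ hi × D p k

  noThreeInSegment : ∀ {lo hi k} → (∀ q → lo < q → q < hi → Interior q) →
                     ∀ {i j l} → InSegment lo hi k i → InSegment lo hi k j → InSegment lo hi k l →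
                     i ≢ j → i ≢ l → j ≢ l → ⊥
  noThreeInSegment inner = distinct-triple λ i<j j<l (lo≤i , _ , di) (_ , _ , dj) (_ , l≤hi , dl) →
    noThreeIncreasing i<j j<l di dj dl (λ q i<q q<l → inner q (≤-<-trans lo≤i i<q) (<-≤-trans q<l l≤hi))

-- A chain enumerates A at positions 0, 1, …, end (position end reads d when end = length A, which
-- closes up a cycle), and every interior position has only its two chain neighbours in G.
record Chain (G : Graph) (d : Vertex G) (A : List (Vertex G)) : Set where
  field
    end        : ℕ
    distinct   : Unique A
    covers     : length A ≤ suc end
    inside     : end ≤ length A
    neighbours : ∀ {p u} → 0 < p → p < end → Adj G (at A d p) u →
                 u ≡ at A d (pred p) ⊎ u ≡ at A d (suc p)

module ChainLevels {G : Graph} {d : Vertex G} {A : List (Vertex G)} (C : Chain G d A) (s : Vertex G) where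
  open Chain C
  open Positions (_≟ᶠ_ {n G})

  D : ℕ → ℕ → Set
  D p x = Dist G s (at A d p) x

  Interior : ℕ → Set
  Interior p = 0 < p × p < end × at A d p ≢ s

  -- At an interior position, a shortest walk from s arrives through a chain neighbour.
  descent : ∀ {p x} → Interior p → D p x → ∃[ x' ] x ≡ suc x' × (D (pred p) x' ⊎ D (suc p) x')
  descent (0<p , p<end , p≢s) dp with dist-step G dp p≢s
  ... | x' , refl , u , uv , du with neighbours 0<p p<end (adj-sym G uv)
  ...   | inj₁ refl = x' , refl , inj₁ du
  ...   | inj₂ refl = x' , refl , inj₂ du

  open Profile D Interior (dist-unique G) descent

  -- Positions of vertices on the chain; sPos is that of s (length A if s is not on A).
  pos : Vertex G → ℕ
  pos = position A

  sPos : ℕ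
  sPos = pos s

  off-source : ∀ {q} → q < end → q ≢ sPos → at A d q ≢ s
  off-source q<end q≢sPos q↦s =
    q≢sPos (trans (sym (position-at distinct (≤-trans q<end inside))) (cong pos q↦s))

  pos≤end : ∀ {a} → a ∈ A → pos a ≤ end
  pos≤end a∈ = ≤-pred (≤-trans (position<length a∈) covers)

  OnLevel : ℕ → Vertex G → Set
  OnLevel k a = a ∈ A × Dist G s a k

  segmentBound : ∀ {k lo hi} → (∀ q → lo < q → q < hi → Interior q) → ∀ {Y} → Unique Y →
                 All (λ a → OnLevel k a × lo ≤ pos a × pos a ≤ hi) Y → length Y ≤ 2
  segmentBound {k} {lo} {hi} inner uY onY = atMostTwo uY onY λ hx hy hz x≢y x≢z y≢z →
    noThreeInSegment inner (inSegment hx) (inSegment hy) (inSegment hz)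
      (x≢y ∘ samePos hx hy) (x≢z ∘ samePos hx hz) (y≢z ∘ samePos hy hz)
    where
    inSegment : ∀ {a} → OnLevel k a × lo ≤ pos a × pos a ≤ hi → InSegment lo hi k (pos a)
    inSegment ((a∈ , da) , lo≤ , ≤hi) = lo≤ , ≤hi , subst (λ v → Dist G s v k) (sym (at-position a∈)) da
    samePos : ∀ {a b} → OnLevel k a × lo ≤ pos a × pos a ≤ hi → OnLevel k b × lo ≤ pos b × pos b ≤ hi →
              pos a ≡ pos b → a ≡ b
    samePos ((a∈ , _) , _) ((b∈ , _) , _) e =
      trans (sym (at-position {d = d} a∈)) (trans (cong (at A d) e) (at-position b∈))

  -- Split the level at the position of s: both parts are segments with interior inner positions.
  levelBound : ∀ {k X} → Unique X → All (OnLevel k) X → length X ≤ 4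
  levelBound {k} {X} uX onX = begin
    length X                   ≡⟨ length-split before? X ⟩
    length Xˡ + length Xʳ      ≤⟨ +-mono-≤ (segmentBound innerˡ (Uniqueₚ.filter⁺ before? uX) onXˡ)
                                            (segmentBound innerʳ (Uniqueₚ.filter⁺ (¬? ∘ before?) uX) onXʳ) ⟩
    4                          ∎
    where
    open ≤-Reasoning
    before? : Decidable (λ a → pos a ≤ sPos)
    before? a = pos a ≤? sPos
    Xˡ = filter before? X
    Xʳ = filter (¬? ∘ before?) X
    onXˡ : All (λ a → OnLevel k a × 0 ≤ pos a × pos a ≤ sPos ⊓ end) Xˡ
    onXˡ = All.zipWith (λ ((a∈ , da) , ≤sPos) → (a∈ , da) , z≤n , ⊓-glb ≤sPos (pos≤end a∈))
             (Allₚ.filter⁺ before? onX , Allₚ.all-filter before? X)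
    onXʳ : All (λ a → OnLevel k a × sPos ≤ pos a × pos a ≤ end) Xʳ
    onXʳ = All.zipWith (λ ((a∈ , da) , ≰sPos) → (a∈ , da) , <⇒≤ (≰⇒> ≰sPos) , pos≤end a∈)
             (Allₚ.filter⁺ (¬? ∘ before?) onX , Allₚ.all-filter (¬? ∘ before?) X)
    innerˡ : ∀ q → 0 < q → q < sPos ⊓ end → Interior q
    innerˡ q 0<q q< = 0<q , m<n⊓o⇒m<o sPos end q< , off-source (m<n⊓o⇒m<o sPos end q<) (<⇒≢ (m<n⊓o⇒m<n sPos end q<))
    innerʳ : ∀ q → sPos < q → q < end → Interior q
    innerʳ q sPos<q q<end = ≤-<-trans z≤n sPos<q , q<end , off-source q<end (>⇒≢ sPos<q)

module _ {G : Graph} where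

  chain-from-degrees : ∀ {d A} end → Unique A → length A ≤ suc end → end ≤ length A →
    (∀ p → suc p ≤ end → Adj G (at A d p) (at A d (suc p))) →
    (∀ p → 0 < p → p < end → at A d (pred p) ≢ at A d (suc p)) →
    (∀ p → 0 < p → p < end → degree G (at A d p) ≡ 2) → Chain G d A
  chain-from-degrees {d} {A} end uA cov ins consecutive separated deg = record
    { end = end ; distinct = uA ; covers = cov ; inside = ins ; neighbours = neighbours }
    where
    neighbours : ∀ {p u} → 0 < p → p < end → Adj G (at A d p) u →
                 u ≡ at A d (pred p) ⊎ u ≡ at A d (suc p)
    neighbours {suc p} 0<p p<end =
      degree-two G (deg (suc p) 0<p p<end) (adj-sym G (consecutive p (<⇒≤ p<end)))
        (consecutive (suc p) p<end) (separated (suc p) 0<p p<end)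

  degree-at : ∀ {d A p} (p< : p < length A) → degree G (lookup A (fromℕ< p<)) ≡ 2 → degree G (at A d p) ≡ 2
  degree-at {d} {A} p< = subst (λ v → degree G v ≡ 2) (at-fromℕ< {xs = A} {d = d} p<)

  pathChain : ∀ {a₀ A'} → Unique (a₀ ∷ A') → Linked (Adj G) (a₀ ∷ A') → PathShape G (a₀ ∷ A') →
              Chain G a₀ (a₀ ∷ A')
  pathChain {a₀} {A'} uA linked path =
    chain-from-degrees (length A') uA ≤-refl (n≤1+n _)
      (λ p sp≤ → at-linked linked (s≤s sp≤))
      (λ p _ p< → pred≢suc-at uA (s≤s p<))
      (λ p 0<p p< → degree-at (m<n⇒m<1+n p<)
         (path (fromℕ< (m<n⇒m<1+n p<)) (subst (0 <_) (sym (toℕ-fromℕ< _)) 0<p)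
               (subst (λ q → suc q < length (a₀ ∷ A')) (sym (toℕ-fromℕ< _)) (s≤s p<))))

  -- A cycle: end = length A reads the first vertex again, closing the cycle.
  cycleChain : ∀ {a₀ A'} → Unique (a₀ ∷ A') → Linked (Adj G) (a₀ ∷ A') → CycleShape G (a₀ ∷ A') →
               Chain G a₀ (a₀ ∷ A')
  cycleChain {a₀} {A'} uA linked (three≤ , closing , cycle) =
    chain-from-degrees (length A) uA (n≤1+n _) ≤-refl consecutive separated
      (λ p 0<p p< → degree-at p< (cycle (fromℕ< p<) (subst (0 <_) (sym (toℕ-fromℕ< p<)) 0<p)))
    where
    A = a₀ ∷ A'
    wraps : ∀ {q} → q ≡ length A → at A a₀ q ≡ a₀
    wraps refl = at-length A
    consecutive : ∀ p → suc p ≤ length A → Adj G (at A a₀ p) (at A a₀ (suc p))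
    consecutive p sp≤ with m≤n⇒m<n∨m≡n sp≤
    ... | inj₁ sp< = at-linked linked sp<
    ... | inj₂ sp≡ = subst (Adj G (at A a₀ p)) (sym (wraps sp≡))
          (subst (λ v → Adj G v a₀) (at-fromℕ< sp≤)
            (closing fzero (fromℕ< sp≤) refl (trans (cong suc (toℕ-fromℕ< sp≤)) sp≡)))
    separated : ∀ p → 0 < p → p < length A → at A a₀ (pred p) ≢ at A a₀ (suc p)
    separated (suc p) _ sp< with m≤n⇒m<n∨m≡n sp<
    ... | inj₁ ssp< = pred≢suc-at uA ssp<
    ... | inj₂ ssp≡ = λ e →
      tooShort (at-injective uA (<-trans (n<1+n p) sp<) (s≤s z≤n) (trans e (wraps ssp≡))) ssp≡
      where
      -- the last vertex of a cycle is joined to the first, so these differ once the cycle has 3 vertices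
      tooShort : p ≡ 0 → suc (suc p) ≡ length A → ⊥
      tooShort refl two≡length = 1+n≰n (subst (3 ≤_) (sym two≡length) three≤)

  branchChain : ∀ {a₀ A'} → BranchShape G (a₀ ∷ A') → Chain G a₀ (a₀ ∷ A')
  branchChain (_ , uA , linked , inj₁ path)  = pathChain uA linked path
  branchChain (_ , uA , linked , inj₂ cycle) = cycleChain uA linked cycle

module _ {X Y : Set} where

  firsts-unique : ∀ {b : Y} {F : List (X × Y)} → Unique F → All (λ p → proj₂ p ≡ b) F →
                  Unique (map proj₁ F)
  firsts-unique []          []       = []
  firsts-unique (p∉ ∷ uF) (e ∷ es) =
    Allₚ.map⁺ (All.zipWith (λ (p≢q , e') eq → p≢q (×-≡,≡→≡ (eq , trans e (sym e')))) (p∉ , es))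
    ∷ firsts-unique uF es

  countByFibres : (_≟_ : DecidableEquality Y) {Q : X → Y → Set} {c : ℕ} →
    (∀ {b} {F : List X} → Unique F → All (λ a → Q a b) F → length F ≤ c) →
    ∀ B {L} → Unique L → All (λ p → Q (proj₁ p) (proj₂ p) × proj₂ p ∈ B) L → length L ≤ c * length B
  countByFibres _≟_ fibre []      {[]}    _ _                = z≤n
  countByFibres _≟_ fibre []      {_ ∷ _} _ ((_ , ()) ∷ _)
  countByFibres _≟_ {Q} {c} fibre (b ∷ B) {L} uL onL = begin
    length L                            ≡⟨ length-split over? L ⟩
    length F + length R                 ≤⟨ +-mono-≤ fibreBound
                                             (countByFibres _≟_ fibre B (Uniqueₚ.filter⁺ (¬? ∘ over?) uL) onR) ⟩
    c + c * length B                    ≡⟨ sym (*-suc c (length B)) ⟩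
    c * length (b ∷ B)                  ∎
    where
    open ≤-Reasoning
    over? : Decidable (λ (p : X × Y) → proj₂ p ≡ b)
    over? p = proj₂ p ≟ b
    F = filter over? L
    R = filter (¬? ∘ over?) L
    fibreBound : length F ≤ c
    fibreBound = subst (_≤ c) (length-map proj₁ F)
      (fibre (firsts-unique (Uniqueₚ.filter⁺ over? uL) (Allₚ.all-filter over? L))
             (Allₚ.map⁺ (All.zipWith (λ { ((q , _) , refl) → q })
                                      (Allₚ.filter⁺ over? onL , Allₚ.all-filter over? L))))
    onR : All (λ p → Q (proj₁ p) (proj₂ p) × proj₂ p ∈ B) R
    onR = All.zipWith (λ { ((q , here e) , p≢b) → ⊥-elim (p≢b e) ; ((q , there p∈) , _) → q , p∈ })
            (Allₚ.filter⁺ (¬? ∘ over?) onL , Allₚ.all-filter (¬? ∘ over?) L)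

module _ (G : Graph) (s : Vertex G) where

  branchLevelBound : ∀ {A k X} → BranchShape G A → Unique X →
                     All (λ a → a ∈ A × Dist G s a k) X → length X ≤ 4
  branchLevelBound {[]}    (() , _)
  branchLevelBound {_ ∷ _} br = ChainLevels.levelBound (branchChain br) s

  sameDistanceBound : ∀ {A b F} → BranchShape G A → Unique F →
                      All (λ a → a ∈ A × SameDist G s a b) F → length F ≤ 4
  sameDistanceBound br [] [] = z≤n
  sameDistanceBound br uF sames@((_ , k , _ , dbk) ∷ _) = branchLevelBound br uF
    (All.map (λ (a∈ , _ , da , db) → a∈ , subst (Dist G s _) (dist-unique G db dbk) da) sames)

  indistinctBound : ∀ {A B L} → BranchShape G A → Unique L → All (Indistinct G s A B) L →
                    length L ≤ 4 * length B
  indistinctBound {B = B} br uL indistinct = countByFibres _≟ᶠ_ (sameDistanceBound br) B uL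
    (All.map (λ { {_ , _} (a∈ , b∈ , same) → (a∈ , same) , b∈ }) indistinct)

  indistinct-swap : ∀ {A B} p → Indistinct G s A B p → Indistinct G s B A (swap p)
  indistinct-swap (a , b) (a∈ , b∈ , k , da , db) = b∈ , a∈ , k , db , da

-- The theorem, with c = 4: count the pairs by their B-component, and, after swapping every
-- pair, by their A-component.
mainTheorem7 : ∃[ c ] (∀ (G : Graph) → Connected G →
    ∀ (A B : List (Vertex G)) → IsBranch G A → IsBranch G B →
    ∀ (s : Vertex G) →
    ∀ (L : List (Vertex G × Vertex G)) → Unique L → All (Indistinct G s A B) L →
    length L ≤ c * (∣ A ∣ᵥ ⊓ ∣ B ∣ᵥ))
mainTheorem7 = 4 , λ G _ A B (brA , _) (brB , _) s L uL indistinct →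
  let byB = indistinctBound G s brA uL indistinct
      byA = subst (_≤ 4 * length A) (length-map swap L)
              (indistinctBound G s brB (Uniqueₚ.map⁺ (cong swap) uL)
                 (Allₚ.map⁺ (All.map (indistinct-swap G s _) indistinct)))
  in subst (length L ≤_) (sym (*-distribˡ-⊓ 4 (length A) (length B))) (⊓-glb byA byB)
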